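{- Let $q=2^h$ with $h$ odd, and let $A_{1,3},A_{1,4},A_{2,3},A_{2,4},A_{3,4}\in\mathbb{F}_{q^4}$ with $(A_{1,3},A_{2,3},A_{3,4})\ne(0,0,0)$. Then the system $A_{2,3}u+A_{1,3}v=0$, $A_{2,4}u+A_{1,4}v=0$, $A_{3,4}v+A_{2,4}(u^q+v^{q^2})+A_{2,3}(u^{q^2}+v^{q^2}+v^q)=0$, $A_{3,4}u+A_{1,4}(u^q+v^{q^2})+A_{1,3}(u^{q^2}+v^{q^2}+v^q)=0$ has at most $q^2$ solutions $(u,v)\in\mathbb{F}_{q^4}^2$. -}

module Defs where

open import Level using (0ℓ)
open import Data.Nat using (ℕ; zero; suc)
open import Data.Fin using (Fin)
open import Data.Product using (∃)
open import Relation.Binary.PropositionalEquality using (_≡_; _≢_)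
open import Algebra.Core using (Op₁; Op₂)
open import Algebra.Structures using (IsCommutativeRing)
open import Function.Bundles using (_↔_)

-- Since finite fields of a given order are unique up to isomorphism, F_{q^4} is
-- represented by an arbitrary FiniteField ((2 ^ h) ^ 4).
record FiniteField (n : ℕ) : Set₁ where
  infixl 6 _+_
  infixl 7 _*_
  field
    Carrier : Set
    _+_ _*_ : Op₂ Carrier
    -_      : Op₁ Carrier
    0# 1#   : Carrier
    isCommutativeRing : IsCommutativeRing _≡_ _+_ _*_ -_ 0# 1#
    0≢1     : 0# ≢ 1#
    inverse : ∀ x → x ≢ 0# → ∃ λ y → x * y ≡ 1#
    enumeration : Carrier ↔ Fin n

  infixr 8 _^_
  _^_ : Carrier → ℕ → Carrier
  x ^ zero  = 1#
  x ^ suc k = x * (x ^ k)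

-- In characteristic 2 the first equation expresses v linearly in u when A₁₃ ≠ 0 and forces u = 0
-- when A₁₃ = 0 ≠ A₂₃; when A₁₃ = A₂₃ = 0 the last two equations make u and v multiples of
-- w = u^q + v^(q²).  In each case the solutions inject into the roots of a trinomial
-- a x + b x^q + c x^(q²) with (a, b, c) ≠ 0, and a nonzero polynomial of degree at most q² has at
-- most q² roots.  The one delicate nondegeneracy (A₁₃ ≠ 0) reduces to y^q (1 + y) ≠ 1 for all y in
-- F_{q⁴}: Frobenius commutes with the Möbius map y ↦ 1/(1+y) of order 3, which forces such a y to be
-- a Frobenius-fixed root of y² + y + 1, impossible because y^q = y² when h is odd.

module Submission where

open import Defs
open import Level using (0ℓ)
open import Data.Nat using (ℕ; zero; suc; _≤_; _%_) renaming (_^_ to _^ℕ_)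
import Data.Nat as ℕ
import Data.Nat.Properties as ℕ
open import Data.Nat.DivMod using (_/_; m≡m%n+[m/n]*n)
open import Data.Nat.Divisibility using (_∣_; divides; m∣m*n; ∣m⇒∣m*n)
open import Data.Fin as Fin using (Fin; punchIn)
open import Data.Fin.Properties using (inj⇒≟; punchInᵢ≢i)
open import Data.Fin.Permutation using (Permutation; permutation)
open import Data.Product using (_×_; _,_; proj₁; proj₂)
open import Data.Bool using (Bool; true; false; _xor_; _∧_)
open import Data.Maybe using (Maybe; nothing; just)
open import Data.Empty using (⊥-elim)
open import Data.List using (List; []; _∷_; length; map)
open import Data.List.Properties using (length-map)
open import Data.List.Relation.Unary.All as All using (All; []; _∷_)
import Data.List.Relation.Unary.All.Properties as All
open import Data.List.Relation.Unary.AllPairs using ([]; _∷_)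
open import Data.List.Relation.Unary.Unique.Propositional using (Unique)
open import Data.Vec.Functional using (replicate)
open import Function using (_∘_)
open import Function.Bundles using (Inverse; _↔_)
open import Function.Properties.Inverse using (↔⇒↣)
open import Relation.Nullary using (¬_; yes; no)
open import Relation.Binary.Definitions using (DecidableEquality)
open import Relation.Binary.PropositionalEquality
open import Algebra.Bundles using (CommutativeRing; RawRing)
import Algebra.Properties.CommutativeSemiring.Exp
import Algebra.Properties.CommutativeMonoid.Sum
import Algebra.Properties.Ring
open import Algebra.Solver.Ring.AlmostCommutativeRing
  using (fromCommutativeRing; _-Raw-AlmostCommutative⟶_)
import Algebra.Solver.Ring

Unique-map⁺ : ∀ {A B : Set} {P : A → Set} {xs : List A} (f : A → B) →
              (∀ {x y} → P x → P y → f x ≡ f y → x ≡ y) →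
              All P xs → Unique xs → Unique (map f xs)
Unique-map⁺ f injective []         []           = []
Unique-map⁺ f injective (px ∷ pxs) (x∉xs ∷ xs!) =
  All.map⁺ (All.zipWith (λ (py , x≢y) fx≡fy → x≢y (injective px py fx≡fy)) (pxs , x∉xs))
  ∷ Unique-map⁺ f injective pxs xs!

module FiniteFieldProperties {N : ℕ} (F : FiniteField N) where
  open FiniteField F public
  open ≡-Reasoning

  commutativeRing : CommutativeRing 0ℓ 0ℓ
  commutativeRing = record { isCommutativeRing = isCommutativeRing }

  open CommutativeRing commutativeRing public
    using ( +-identityˡ; +-identityʳ; +-assoc; -‿inverseˡ
          ; *-identityˡ; *-identityʳ; *-assoc; *-comm; zeroˡ; zeroʳ; distribˡ )
  open CommutativeRing commutativeRing
    using (ring; commutativeSemiring; *-commutativeMonoid)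

  infix 4 _≟_
  _≟_ : DecidableEquality Carrier
  _≟_ = inj⇒≟ (↔⇒↣ enumeration)

  _⁻¹⟨_⟩ : (x : Carrier) → x ≢ 0# → Carrier
  x ⁻¹⟨ x≢0 ⟩ = proj₁ (inverse x x≢0)

  *-inverseˡ : ∀ {x} (x≢0 : x ≢ 0#) → x ⁻¹⟨ x≢0 ⟩ * x ≡ 1#
  *-inverseˡ {x} x≢0 = trans (*-comm _ x) (proj₂ (inverse x x≢0))

  *-solveˡ : ∀ {x y z} (x≢0 : x ≢ 0#) → x * y ≡ z → y ≡ x ⁻¹⟨ x≢0 ⟩ * z
  *-solveˡ {x} {y} {z} x≢0 xy≡z = begin
    y                          ≡⟨ sym (*-identityˡ y) ⟩
    1# * y                     ≡⟨ cong (_* y) (sym (*-inverseˡ x≢0)) ⟩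
    (x ⁻¹⟨ x≢0 ⟩ * x) * y      ≡⟨ *-assoc _ x y ⟩
    x ⁻¹⟨ x≢0 ⟩ * (x * y)      ≡⟨ cong (x ⁻¹⟨ x≢0 ⟩ *_) xy≡z ⟩
    x ⁻¹⟨ x≢0 ⟩ * z            ∎

  *-cancelˡ-0 : ∀ {x y} → x ≢ 0# → x * y ≡ 0# → y ≡ 0#
  *-cancelˡ-0 x≢0 xy≡0 = trans (*-solveˡ x≢0 xy≡0) (zeroʳ _)

  *-≢0 : ∀ {x y} → x ≢ 0# → y ≢ 0# → x * y ≢ 0#
  *-≢0 x≢0 y≢0 xy≡0 = y≢0 (*-cancelˡ-0 x≢0 xy≡0)

  module Exp = Algebra.Properties.CommutativeSemiring.Exp commutativeSemiring

  ^≡^ᴿ : ∀ x n → x ^ n ≡ x Exp.^ n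
  ^≡^ᴿ x zero    = refl
  ^≡^ᴿ x (suc n) = cong (x *_) (^≡^ᴿ x n)

  ^-assocʳ : ∀ x m n → (x ^ m) ^ n ≡ x ^ (m ℕ.* n)
  ^-assocʳ x m n rewrite ^≡^ᴿ (x ^ m) n | ^≡^ᴿ x m | ^≡^ᴿ x (m ℕ.* n) = Exp.^-assocʳ x m n

  ^-distrib-* : ∀ x y n → (x * y) ^ n ≡ x ^ n * y ^ n
  ^-distrib-* x y n rewrite ^≡^ᴿ (x * y) n | ^≡^ᴿ x n | ^≡^ᴿ y n = Exp.^-distrib-* x y n

  1^n≡1 : ∀ n → 1# ^ n ≡ 1#
  1^n≡1 zero    = refl
  1^n≡1 (suc n) = trans (*-identityˡ _) (1^n≡1 n)

  0^n≡0 : ∀ {n} → 0 ℕ.< n → 0# ^ n ≡ 0#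
  0^n≡0 {suc n} _ = zeroˡ _

  module Π = Algebra.Properties.CommutativeMonoid.Sum *-commutativeMonoid

  ∏ : ∀ {n} → (Fin n → Carrier) → Carrier
  ∏ = Π.sum

  ∏-≢0 : ∀ {n} (t : Fin n → Carrier) → (∀ i → t i ≢ 0#) → ∏ t ≢ 0#
  ∏-≢0 {zero}  t t≢0 = 0≢1 ∘ sym
  ∏-≢0 {suc n} t t≢0 = *-≢0 (t≢0 Fin.zero) (∏-≢0 (t ∘ Fin.suc) (t≢0 ∘ Fin.suc))

  -- The product of unitPart over all elements is the product of the units; multiplying the
  -- elements by a unit a permutes them and multiplies each unitPart by scaledBy a.
  unitPart : Carrier → Carrier
  unitPart x with x ≟ 0#
  ... | yes _ = 1#
  ... | no  _ = x

  scaledBy : Carrier → Carrier → Carrier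
  scaledBy a x with x ≟ 0#
  ... | yes _ = 1#
  ... | no  _ = a

  unitPart-≢0 : ∀ x → unitPart x ≢ 0#
  unitPart-≢0 x with x ≟ 0#
  ... | yes _   = 0≢1 ∘ sym
  ... | no  x≢0 = x≢0

  unitPart-* : ∀ {a} → a ≢ 0# → ∀ x → unitPart (a * x) ≡ scaledBy a x * unitPart x
  unitPart-* {a} a≢0 x with x ≟ 0#
  ... | yes refl = begin
    unitPart (a * 0#) ≡⟨ cong unitPart (zeroʳ a) ⟩
    unitPart 0#       ≡⟨ unitPart-0 ⟩
    1#                ≡⟨ sym (*-identityˡ 1#) ⟩
    1# * 1#           ∎
    where
    unitPart-0 : unitPart 0# ≡ 1#
    unitPart-0 with 0# ≟ 0#
    ... | yes _   = refl
    ... | no  0≢0 = ⊥-elim (0≢0 refl)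
  ... | no x≢0 with a * x ≟ 0#
  ...   | yes ax≡0 = ⊥-elim (*-≢0 a≢0 x≢0 ax≡0)
  ...   | no  _    = refl

  ≡*⇒≡1 : ∀ {x y} → x ≢ 0# → x ≡ y * x → y ≡ 1#
  ≡*⇒≡1 {x} {y} x≢0 x≡yx = begin
    y                         ≡⟨ *-solveˡ x≢0 (trans (*-comm x y) (sym x≡yx)) ⟩
    x ⁻¹⟨ x≢0 ⟩ * x           ≡⟨ *-inverseˡ x≢0 ⟩
    1#                        ∎

  module _ {M : ℕ} (e : Carrier ↔ Fin (suc M)) {a : Carrier} (a≢0 : a ≢ 0#) where
    open Inverse e using (to; from; strictlyInverseˡ; strictlyInverseʳ)

    a⁻¹ : Carrier
    a⁻¹ = a ⁻¹⟨ a≢0 ⟩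

    cancel : ∀ {b c} → b * c ≡ 1# → ∀ x → b * (c * x) ≡ x
    cancel {b} {c} bc≡1 x = trans (sym (*-assoc b c x)) (trans (cong (_* x) bc≡1) (*-identityˡ x))

    multiplication : Permutation (suc M) (suc M)
    multiplication = permutation (λ i → to (a * from i)) (λ i → to (a⁻¹ * from i))
      (λ i → trans (cong (λ y → to (a * y)) (strictlyInverseʳ _))
                   (trans (cong to (cancel (proj₂ (inverse a a≢0)) _)) (strictlyInverseˡ i)))
      (λ i → trans (cong (λ y → to (a⁻¹ * y)) (strictlyInverseʳ _))
                   (trans (cong to (cancel (*-inverseˡ a≢0) _)) (strictlyInverseˡ i)))

    ∏-scaledBy : ∏ (scaledBy a ∘ from) ≡ a ^ M
    ∏-scaledBy = begin
      ∏ (scaledBy a ∘ from)                           ≡⟨ Π.sum-remove {i = to 0#} (scaledBy a ∘ from) ⟩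
      scaledBy a (from (to 0#)) * ∏ (λ j → scaledBy a (from (punchIn (to 0#) j)))
        ≡⟨ cong₂ _*_ scaledBy-0 (Π.sum-cong-≗ scaledBy-≢0) ⟩
      1# * ∏ (replicate M a)                          ≡⟨ *-identityˡ _ ⟩
      ∏ (replicate M a)                               ≡⟨ trans (Π.sum-replicate M) (sym (^≡^ᴿ a M)) ⟩
      a ^ M                                           ∎
      where
      scaledBy-0 : scaledBy a (from (to 0#)) ≡ 1#
      scaledBy-0 with from (to 0#) ≟ 0#
      ... | yes _ = refl
      ... | no ≢0 = ⊥-elim (≢0 (strictlyInverseʳ 0#))
      scaledBy-≢0 : ∀ j → scaledBy a (from (punchIn (to 0#) j)) ≡ a
      scaledBy-≢0 j with from (punchIn (to 0#) j) ≟ 0#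
      ... | yes ≡0 = ⊥-elim (punchInᵢ≢i (to 0#) j (trans (sym (strictlyInverseˡ _)) (cong to ≡0)))
      ... | no  _  = refl

    ∏-unitPart-invariant : ∏ (unitPart ∘ from) ≡ a ^ M * ∏ (unitPart ∘ from)
    ∏-unitPart-invariant = begin
      ∏ (unitPart ∘ from)                             ≡⟨ Π.sum-permute (unitPart ∘ from) multiplication ⟩
      ∏ (λ i → unitPart (from (to (a * from i))))
        ≡⟨ Π.sum-cong-≗ (λ i → trans (cong unitPart (strictlyInverseʳ _)) (unitPart-* a≢0 (from i))) ⟩
      ∏ (λ i → scaledBy a (from i) * unitPart (from i)) ≡⟨ Π.∑-distrib-+ (scaledBy a ∘ from) (unitPart ∘ from) ⟩
      ∏ (scaledBy a ∘ from) * ∏ (unitPart ∘ from)     ≡⟨ cong (_* ∏ (unitPart ∘ from)) ∏-scaledBy ⟩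
      a ^ M * ∏ (unitPart ∘ from)                     ∎

    ^-pred-order≡1 : a ^ M ≡ 1#
    ^-pred-order≡1 = ≡*⇒≡1 (∏-≢0 (unitPart ∘ from) (unitPart-≢0 ∘ from)) ∏-unitPart-invariant

  ^-order-enumerated : ∀ {K} → Carrier ↔ Fin K → ∀ a → a ^ K ≡ a
  ^-order-enumerated {zero} e a with Inverse.to e a
  ... | ()
  ^-order-enumerated {suc M} e a with a ≟ 0#
  ... | yes refl = zeroˡ _
  ... | no  a≢0  = trans (cong (a *_) (^-pred-order≡1 e a≢0)) (*-identityʳ a)

  fermat : ∀ a → a ^ N ≡ a
  fermat = ^-order-enumerated enumeration

  -- (-1)^N is -1 by Fermat and 1 when N is even.
  characteristic-two : 2 ∣ N → 1# + 1# ≡ 0#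
  characteristic-two (divides t N≡t*2) = begin
    1# + 1#      ≡⟨ cong (_+ 1#) 1≡-1 ⟩
    - 1# + 1#    ≡⟨ -‿inverseˡ 1# ⟩
    0#           ∎
    where
    open Algebra.Properties.Ring ring using (-1*x≈-x; -‿involutive)
    [-1]²≡1 : (- 1#) ^ 2 ≡ 1#
    [-1]²≡1 = begin
      - 1# * (- 1# * 1#) ≡⟨ cong (- 1# *_) (*-identityʳ _) ⟩
      - 1# * - 1#        ≡⟨ -1*x≈-x (- 1#) ⟩
      - (- 1#)           ≡⟨ -‿involutive 1# ⟩
      1#                 ∎
    1≡-1 : 1# ≡ - 1#
    1≡-1 = begin
      1#                  ≡⟨ sym (1^n≡1 t) ⟩
      1# ^ t              ≡⟨ cong (_^ t) (sym [-1]²≡1) ⟩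
      ((- 1#) ^ 2) ^ t    ≡⟨ ^-assocʳ (- 1#) 2 t ⟩
      (- 1#) ^ (2 ℕ.* t)  ≡⟨ cong ((- 1#) ^_) (sym (trans N≡t*2 (ℕ.*-comm t 2))) ⟩
      (- 1#) ^ N          ≡⟨ fermat (- 1#) ⟩
      - 1#                ∎

module CharacteristicTwo {N : ℕ} (F : FiniteField N)
  (1+1≡0 : FiniteField._+_ F (FiniteField.1# F) (FiniteField.1# F) ≡ FiniteField.0# F) where
  open FiniteFieldProperties F public
  open ≡-Reasoning

  x+x≡0 : ∀ x → x + x ≡ 0#
  x+x≡0 x = begin
    x + x             ≡⟨ sym (cong₂ _+_ (*-identityʳ x) (*-identityʳ x)) ⟩
    x * 1# + x * 1#   ≡⟨ sym (distribˡ x 1# 1#) ⟩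
    x * (1# + 1#)     ≡⟨ cong (x *_) 1+1≡0 ⟩
    x * 0#            ≡⟨ zeroʳ x ⟩
    0#                ∎

  -x≡x : ∀ x → - x ≡ x
  -x≡x x = begin
    - x               ≡⟨ sym (+-identityʳ _) ⟩
    - x + 0#          ≡⟨ cong (- x +_) (sym (x+x≡0 x)) ⟩
    - x + (x + x)     ≡⟨ sym (+-assoc _ _ _) ⟩
    (- x + x) + x     ≡⟨ cong (_+ x) (-‿inverseˡ x) ⟩
    0# + x            ≡⟨ +-identityˡ x ⟩
    x                 ∎

  -- Running the ring solver with coefficients in 𝔽₂ makes it prove identities of characteristic 2.

  𝔽₂ : RawRing 0ℓ 0ℓ
  𝔽₂ = record { Carrier = Bool ; _≈_ = _≡_ ; _+_ = _xor_ ; _*_ = _∧_ ; -_ = λ b → b ; 0# = false ; 1# = true }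

  ⟦_⟧₂ : Bool → Carrier
  ⟦ true  ⟧₂ = 1#
  ⟦ false ⟧₂ = 0#

  ⟦⟧₂-homo-+ : ∀ a b → ⟦ a xor b ⟧₂ ≡ ⟦ a ⟧₂ + ⟦ b ⟧₂
  ⟦⟧₂-homo-+ true  true  = sym 1+1≡0
  ⟦⟧₂-homo-+ true  false = sym (+-identityʳ 1#)
  ⟦⟧₂-homo-+ false true  = sym (+-identityˡ 1#)
  ⟦⟧₂-homo-+ false false = sym (+-identityˡ 0#)

  ⟦⟧₂-homo-* : ∀ a b → ⟦ a ∧ b ⟧₂ ≡ ⟦ a ⟧₂ * ⟦ b ⟧₂
  ⟦⟧₂-homo-* true  b = sym (*-identityˡ _)
  ⟦⟧₂-homo-* false b = sym (zeroˡ _)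

  𝔽₂⟶F : 𝔽₂ -Raw-AlmostCommutative⟶ fromCommutativeRing commutativeRing
  𝔽₂⟶F = record
    { ⟦_⟧ = ⟦_⟧₂ ; +-homo = ⟦⟧₂-homo-+ ; *-homo = ⟦⟧₂-homo-* ; -‿homo = λ _ → sym (-x≡x _)
    ; 0-homo = refl ; 1-homo = refl }

  ⟦⟧₂-≡? : ∀ a b → Maybe (⟦ a ⟧₂ ≡ ⟦ b ⟧₂)
  ⟦⟧₂-≡? true  true  = just refl
  ⟦⟧₂-≡? false false = just refl
  ⟦⟧₂-≡? _     _     = nothing

  open Algebra.Solver.Ring 𝔽₂ (fromCommutativeRing commutativeRing) 𝔽₂⟶F ⟦⟧₂-≡? public
    using (Polynomial; solve; _:=_; _:+_; _:*_; con)

  𝟘 𝟙 : ∀ {n} → Polynomial n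
  𝟘 = con false
  𝟙 = con true

  x+y≡0⇒x≡y : ∀ {x y} → x + y ≡ 0# → x ≡ y
  x+y≡0⇒x≡y {x} {y} x+y≡0 = begin
    x                 ≡⟨ solve 2 (λ x y → x := (x :+ y) :+ y) refl x y ⟩
    (x + y) + y       ≡⟨ cong (_+ y) x+y≡0 ⟩
    0# + y            ≡⟨ +-identityˡ y ⟩
    y                 ∎

  a≡0⇒x+a*y≡x : ∀ {a} x y → a ≡ 0# → x + a * y ≡ x
  a≡0⇒x+a*y≡x x y refl = solve 2 (λ x y → x :+ 𝟘 :* y := x) refl x y

  frobenius-+ : ∀ k x y → (x + y) ^ (2 ^ℕ k) ≡ x ^ (2 ^ℕ k) + y ^ (2 ^ℕ k)
  frobenius-+ zero    = solve 2 (λ x y → (x :+ y) :* 𝟙 := x :* 𝟙 :+ y :* 𝟙) refl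
  frobenius-+ (suc k) x y = begin
    (x + y) ^ (2 ℕ.* 2 ^ℕ k)            ≡⟨ sym (^-assocʳ (x + y) 2 (2 ^ℕ k)) ⟩
    ((x + y) ^ 2) ^ (2 ^ℕ k)            ≡⟨ cong (_^ (2 ^ℕ k)) (square-+ x y) ⟩
    (x ^ 2 + y ^ 2) ^ (2 ^ℕ k)          ≡⟨ frobenius-+ k (x ^ 2) (y ^ 2) ⟩
    (x ^ 2) ^ (2 ^ℕ k) + (y ^ 2) ^ (2 ^ℕ k) ≡⟨ cong₂ _+_ (^-assocʳ x 2 (2 ^ℕ k)) (^-assocʳ y 2 (2 ^ℕ k)) ⟩
    x ^ (2 ℕ.* 2 ^ℕ k) + y ^ (2 ℕ.* 2 ^ℕ k) ∎
    where
    square-+ : ∀ x y → (x + y) ^ 2 ≡ x ^ 2 + y ^ 2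
    square-+ = solve 2 (λ x y → (x :+ y) :* ((x :+ y) :* 𝟙) := x :* (x :* 𝟙) :+ y :* (y :* 𝟙)) refl

  -- Polynomials are coefficient lists, constant term first.

  eval : List Carrier → Carrier → Carrier
  eval []       x = 0#
  eval (c ∷ cs) x = c + x * eval cs x

  IsRoot : List Carrier → Carrier → Set
  IsRoot p x = eval p x ≡ 0#

  IsZero : List Carrier → Set
  IsZero = All (_≡ 0#)

  -- Synthetic division by x + r, which is x - r in characteristic 2.
  quotient : Carrier → List Carrier → List Carrier
  quotient r []            = []
  quotient r (c ∷ [])      = []
  quotient r (c ∷ c′ ∷ cs) = eval (c′ ∷ cs) r ∷ quotient r (c′ ∷ cs)

  length-quotient : ∀ r c cs → length (quotient r (c ∷ cs)) ≡ length cs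
  length-quotient r c []        = refl
  length-quotient r c (c′ ∷ cs) = cong suc (length-quotient r c′ cs)

  eval-division : ∀ r p x → eval p x ≡ (x + r) * eval (quotient r p) x + eval p r
  eval-division r []       x = solve 2 (λ x r → 𝟘 := (x :+ r) :* 𝟘 :+ 𝟘) refl x r
  eval-division r (c ∷ []) x = solve 3 (λ c x r → c :+ x :* 𝟘 := (x :+ r) :* 𝟘 :+ (c :+ r :* 𝟘)) refl c x r
  eval-division r (c ∷ c′ ∷ cs) x = begin
    c + x * eval (c′ ∷ cs) x             ≡⟨ cong (λ y → c + x * y) (eval-division r (c′ ∷ cs) x) ⟩
    c + x * ((x + r) * q + e)            ≡⟨ solve 5 (λ c x r q e → c :+ x :* ((x :+ r) :* q :+ e)
                                                               := (x :+ r) :* (e :+ x :* q) :+ (c :+ r :* e))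
                                                  refl c x r q e ⟩
    (x + r) * (e + x * q) + (c + r * e)  ∎
    where
    q = eval (quotient r (c′ ∷ cs)) x
    e = eval (c′ ∷ cs) r

  quotient-IsRoot : ∀ {r s} p → r ≢ s → IsRoot p r → IsRoot p s → IsRoot (quotient r p) s
  quotient-IsRoot {r} {s} p r≢s p[r]≡0 p[s]≡0 = *-cancelˡ-0 s+r≢0 (begin
    (s + r) * q             ≡⟨ sym (+-identityʳ _) ⟩
    (s + r) * q + 0#        ≡⟨ cong ((s + r) * q +_) (sym p[r]≡0) ⟩
    (s + r) * q + eval p r  ≡⟨ sym (eval-division r p s) ⟩
    eval p s                ≡⟨ p[s]≡0 ⟩
    0#                      ∎)
    where
    q = eval (quotient r p) s
    s+r≢0 : s + r ≢ 0#
    s+r≢0 s+r≡0 = r≢s (sym (x+y≡0⇒x≡y s+r≡0))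

  IsZero⇒IsRoot : ∀ {p} → IsZero p → ∀ x → IsRoot p x
  IsZero⇒IsRoot {[]}     []          x = refl
  IsZero⇒IsRoot {c ∷ cs} (c≡0 ∷ cs≡0) x = begin
    c + x * eval cs x                    ≡⟨ cong₂ (λ a b → a + x * b) c≡0 (IsZero⇒IsRoot cs≡0 x) ⟩
    0# + x * 0#                          ≡⟨ solve 1 (λ x → 𝟘 :+ x :* 𝟘 := 𝟘) refl x ⟩
    0#                                   ∎

  IsRoot⇒head≡0 : ∀ {c cs r} → IsZero cs → IsRoot (c ∷ cs) r → c ≡ 0#
  IsRoot⇒head≡0 {c} {cs} {r} cs≡0 p[r]≡0 = begin
    c                    ≡⟨ solve 2 (λ c r → c := c :+ r :* 𝟘) refl c r ⟩
    c + r * 0#           ≡⟨ cong (λ y → c + r * y) (sym (IsZero⇒IsRoot cs≡0 r)) ⟩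
    eval (c ∷ cs) r      ≡⟨ p[r]≡0 ⟩
    0#                   ∎

  IsZero-quotient⇒IsZero : ∀ r p → IsZero (quotient r p) → IsRoot p r → IsZero p
  IsZero-quotient⇒IsZero r []            _                _      = []
  IsZero-quotient⇒IsZero r (c ∷ [])      _                p[r]≡0 = IsRoot⇒head≡0 [] p[r]≡0 ∷ []
  IsZero-quotient⇒IsZero r (c ∷ c′ ∷ cs) (t[r]≡0 ∷ q≡0) p[r]≡0 = IsRoot⇒head≡0 t≡0 p[r]≡0 ∷ t≡0
    where
    t≡0 = IsZero-quotient⇒IsZero r (c′ ∷ cs) q≡0 t[r]≡0

  length≤#roots⇒IsZero : ∀ {rs} p → Unique rs → All (IsRoot p) rs → length p ≤ length rs → IsZero p
  length≤#roots⇒IsZero []       _               _                   _           = []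
  length≤#roots⇒IsZero {r ∷ rs} (c ∷ cs) (r∉rs ∷ rs!) (p[r]≡0 ∷ p[rs]≡0) (ℕ.s≤s |cs|≤|rs|) =
    IsZero-quotient⇒IsZero r (c ∷ cs) quotient≡0 p[r]≡0
    where
    quotient≡0 : IsZero (quotient r (c ∷ cs))
    quotient≡0 = length≤#roots⇒IsZero (quotient r (c ∷ cs)) rs!
      (All.zipWith (λ (r≢s , p[s]≡0) → quotient-IsRoot (c ∷ cs) r≢s p[r]≡0 p[s]≡0) (r∉rs , p[rs]≡0))
      (subst (_≤ length rs) (sym (length-quotient r c cs)) |cs|≤|rs|)

  monomial : Carrier → ℕ → List Carrier
  monomial c zero    = c ∷ []
  monomial c (suc k) = 0# ∷ monomial c k

  infixl 6 _⊕_
  _⊕_ : List Carrier → List Carrier → List Carrier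
  []      ⊕ q       = q
  (a ∷ p) ⊕ []      = a ∷ p
  (a ∷ p) ⊕ (b ∷ q) = (a + b) ∷ (p ⊕ q)

  coeff : List Carrier → ℕ → Carrier
  coeff []       i       = 0#
  coeff (c ∷ cs) zero    = c
  coeff (c ∷ cs) (suc i) = coeff cs i

  eval-monomial : ∀ c k x → eval (monomial c k) x ≡ c * x ^ k
  eval-monomial c zero    x = solve 2 (λ c x → c :+ x :* 𝟘 := c :* 𝟙) refl c x
  eval-monomial c (suc k) x = begin
    0# + x * eval (monomial c k) x  ≡⟨ cong (λ y → 0# + x * y) (eval-monomial c k x) ⟩
    0# + x * (c * x ^ k)            ≡⟨ solve 3 (λ c x y → 𝟘 :+ x :* (c :* y) := c :* (x :* y)) refl c x (x ^ k) ⟩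
    c * (x * x ^ k)                 ∎

  eval-⊕ : ∀ p q x → eval (p ⊕ q) x ≡ eval p x + eval q x
  eval-⊕ []      q       x = sym (+-identityˡ _)
  eval-⊕ (a ∷ p) []      x = sym (+-identityʳ _)
  eval-⊕ (a ∷ p) (b ∷ q) x = begin
    (a + b) + x * eval (p ⊕ q) x               ≡⟨ cong (λ y → (a + b) + x * y) (eval-⊕ p q x) ⟩
    (a + b) + x * (eval p x + eval q x)        ≡⟨ solve 5 (λ a b x y z → (a :+ b) :+ x :* (y :+ z)
                                                                     := (a :+ x :* y) :+ (b :+ x :* z))
                                                        refl a b x (eval p x) (eval q x) ⟩
    (a + x * eval p x) + (b + x * eval q x)    ∎

  length-monomial : ∀ c k → length (monomial c k) ≡ suc k
  length-monomial c zero    = refl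
  length-monomial c (suc k) = cong suc (length-monomial c k)

  length-⊕ : ∀ p q → length (p ⊕ q) ≡ length p ℕ.⊔ length q
  length-⊕ []      q       = refl
  length-⊕ (a ∷ p) []      = refl
  length-⊕ (a ∷ p) (b ∷ q) = cong suc (length-⊕ p q)

  coeff-⊕ : ∀ p q i → coeff (p ⊕ q) i ≡ coeff p i + coeff q i
  coeff-⊕ []      q       i       = sym (+-identityˡ _)
  coeff-⊕ (a ∷ p) []      zero    = sym (+-identityʳ _)
  coeff-⊕ (a ∷ p) []      (suc i) = sym (+-identityʳ _)
  coeff-⊕ (a ∷ p) (b ∷ q) zero    = refl
  coeff-⊕ (a ∷ p) (b ∷ q) (suc i) = coeff-⊕ p q i

  coeff-monomial-≡ : ∀ c k → coeff (monomial c k) k ≡ c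
  coeff-monomial-≡ c zero    = refl
  coeff-monomial-≡ c (suc k) = coeff-monomial-≡ c k

  coeff-monomial-≢ : ∀ c {k i} → i ≢ k → coeff (monomial c k) i ≡ 0#
  coeff-monomial-≢ c {zero}  {zero}  0≢0 = ⊥-elim (0≢0 refl)
  coeff-monomial-≢ c {zero}  {suc i} _   = refl
  coeff-monomial-≢ c {suc k} {zero}  _   = refl
  coeff-monomial-≢ c {suc k} {suc i} i≢k = coeff-monomial-≢ c (i≢k ∘ cong suc)

  IsZero⇒coeff≡0 : ∀ {p} → IsZero p → ∀ i → coeff p i ≡ 0#
  IsZero⇒coeff≡0 []          i       = refl
  IsZero⇒coeff≡0 (c≡0 ∷ _)   zero    = c≡0
  IsZero⇒coeff≡0 (_ ∷ cs≡0)  (suc i) = IsZero⇒coeff≡0 cs≡0 i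

  trinomial : ℕ → ℕ → Carrier → Carrier → Carrier → List Carrier
  trinomial q Q a b c = monomial a 1 ⊕ monomial b q ⊕ monomial c Q

  eval-trinomial : ∀ q Q a b c x → eval (trinomial q Q a b c) x ≡ a * x + b * x ^ q + c * x ^ Q
  eval-trinomial q Q a b c x = begin
    eval (monomial a 1 ⊕ monomial b q ⊕ monomial c Q) x
      ≡⟨ trans (eval-⊕ (monomial a 1 ⊕ monomial b q) (monomial c Q) x)
               (cong (_+ eval (monomial c Q) x) (eval-⊕ (monomial a 1) (monomial b q) x)) ⟩
    eval (monomial a 1) x + eval (monomial b q) x + eval (monomial c Q) x
      ≡⟨ cong₂ _+_ (cong₂ _+_ (eval-monomial a 1 x) (eval-monomial b q x)) (eval-monomial c Q x) ⟩
    a * x ^ 1 + b * x ^ q + c * x ^ Q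
      ≡⟨ cong (λ y → a * y + b * x ^ q + c * x ^ Q) (*-identityʳ x) ⟩
    a * x + b * x ^ q + c * x ^ Q ∎

  module _ {q Q : ℕ} (1<q : 1 ℕ.< q) (q<Q : q ℕ.< Q) {a b c : Carrier} where
    length-trinomial : length (trinomial q Q a b c) ≡ suc Q
    length-trinomial = begin
      length (monomial a 1 ⊕ monomial b q ⊕ monomial c Q)
        ≡⟨ trans (length-⊕ (monomial a 1 ⊕ monomial b q) (monomial c Q))
                 (cong (ℕ._⊔ length (monomial c Q)) (length-⊕ (monomial a 1) (monomial b q))) ⟩
      length (monomial a 1) ℕ.⊔ length (monomial b q) ℕ.⊔ length (monomial c Q)
        ≡⟨ cong₂ ℕ._⊔_ (cong₂ ℕ._⊔_ (length-monomial a 1) (length-monomial b q)) (length-monomial c Q) ⟩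
      2 ℕ.⊔ suc q ℕ.⊔ suc Q
        ≡⟨ cong (ℕ._⊔ suc Q) (ℕ.m≤n⇒m⊔n≡n (ℕ.s≤s (ℕ.<⇒≤ 1<q))) ⟩
      suc q ℕ.⊔ suc Q
        ≡⟨ ℕ.m≤n⇒m⊔n≡n (ℕ.s≤s (ℕ.<⇒≤ q<Q)) ⟩
      suc Q ∎

    IsZero-trinomial : IsZero (trinomial q Q a b c) → a ≡ 0# × b ≡ 0# × c ≡ 0#
    IsZero-trinomial t≡0 = coefficient 1 a≡ , coefficient q b≡ , coefficient Q c≡
      where
      1<Q = ℕ.<-trans 1<q q<Q
      coeff-trinomial : ∀ i → coeff (trinomial q Q a b c) i
                            ≡ coeff (monomial a 1) i + coeff (monomial b q) i + coeff (monomial c Q) i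
      coeff-trinomial i = trans (coeff-⊕ (monomial a 1 ⊕ monomial b q) (monomial c Q) i)
                                (cong (_+ coeff (monomial c Q) i) (coeff-⊕ (monomial a 1) (monomial b q) i))
      coefficient : ∀ i {x} → coeff (trinomial q Q a b c) i ≡ x → x ≡ 0#
      coefficient i t[i]≡x = trans (sym t[i]≡x) (IsZero⇒coeff≡0 t≡0 i)
      a≡ : coeff (trinomial q Q a b c) 1 ≡ a
      a≡ = begin
        coeff (trinomial q Q a b c) 1  ≡⟨ coeff-trinomial 1 ⟩
        _                              ≡⟨ cong₂ _+_ (cong₂ _+_ (coeff-monomial-≡ a 1) (coeff-monomial-≢ b (ℕ.<⇒≢ 1<q)))
                                                    (coeff-monomial-≢ c (ℕ.<⇒≢ 1<Q)) ⟩
        a + 0# + 0#                    ≡⟨ trans (+-identityʳ _) (+-identityʳ a) ⟩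
        a                              ∎
      b≡ : coeff (trinomial q Q a b c) q ≡ b
      b≡ = begin
        coeff (trinomial q Q a b c) q  ≡⟨ coeff-trinomial q ⟩
        _                              ≡⟨ cong₂ _+_ (cong₂ _+_ (coeff-monomial-≢ a (ℕ.>⇒≢ 1<q)) (coeff-monomial-≡ b q))
                                                    (coeff-monomial-≢ c (ℕ.<⇒≢ q<Q)) ⟩
        0# + b + 0#                    ≡⟨ trans (+-identityʳ _) (+-identityˡ b) ⟩
        b                              ∎
      c≡ : coeff (trinomial q Q a b c) Q ≡ c
      c≡ = begin
        coeff (trinomial q Q a b c) Q  ≡⟨ coeff-trinomial Q ⟩
        _                              ≡⟨ cong₂ _+_ (cong₂ _+_ (coeff-monomial-≢ a (ℕ.>⇒≢ 1<Q)) (coeff-monomial-≢ b (ℕ.>⇒≢ q<Q)))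
                                                    (coeff-monomial-≡ c Q) ⟩
        0# + 0# + c                    ≡⟨ trans (cong (_+ c) (+-identityˡ 0#)) (+-identityˡ c) ⟩
        c                              ∎

    module _ (abc≢0 : ¬ (a ≡ 0# × b ≡ 0# × c ≡ 0#)) where
      trinomial-roots-length≤ : ∀ {rs} → Unique rs → All (λ x → a * x + b * x ^ q + c * x ^ Q ≡ 0#) rs →
                                length rs ≤ Q
      trinomial-roots-length≤ {rs} rs! roots with length rs ℕ.≤? Q
      ... | yes |rs|≤Q = |rs|≤Q
      ... | no  |rs|≰Q = ⊥-elim (abc≢0 (IsZero-trinomial (length≤#roots⇒IsZero (trinomial q Q a b c) rs!
              (All.map (λ {x} → trans (eval-trinomial q Q a b c x)) roots)
              (subst (_≤ length rs) (sym length-trinomial) (ℕ.≰⇒> |rs|≰Q)))))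

      injection-into-trinomial-roots⇒length≤ :
        ∀ {S : Set} {P : S → Set} (f : S → Carrier) →
        (∀ {s t} → P s → P t → f s ≡ f t → s ≡ t) →
        (∀ {s} → P s → a * f s + b * f s ^ q + c * f s ^ Q ≡ 0#) →
        ∀ {sols} → Unique sols → All P sols → length sols ≤ Q
      injection-into-trinomial-roots⇒length≤ f injective root {sols} sols! P[sols] =
        subst (_≤ Q) (length-map f sols)
          (trinomial-roots-length≤ (Unique-map⁺ f injective P[sols] sols!) (All.map⁺ (All.map root P[sols])))

  -- The relation y * (1 + x) ≡ 1 says y = g(x) for the Möbius map g(x) = 1/(1+x), and g³ = id.
  mobius-order-three : ∀ {x₀ x₁ x₂ x₃} → x₁ * (1# + x₀) ≡ 1# → x₂ * (1# + x₁) ≡ 1# → x₃ * (1# + x₂) ≡ 1# →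
                       x₃ ≡ x₀
  mobius-order-three {x₀} {x₁} {x₂} {x₃} e₁ e₂ e₃ = begin
    x₃                        ≡⟨ solve 2 (λ x₃ x₀ → x₃ := x₃ :* (x₀ :+ (𝟙 :+ x₀))) refl x₃ x₀ ⟩
    x₃ * (x₀ + (1# + x₀))     ≡⟨ cong (λ y → x₃ * (x₀ + y)) (sym x₂x₀≡1+x₀) ⟩
    x₃ * (x₀ + x₂ * x₀)       ≡⟨ solve 3 (λ x₀ x₂ x₃ → x₃ :* (x₀ :+ x₂ :* x₀) := x₀ :* (x₃ :* (𝟙 :+ x₂))) refl x₀ x₂ x₃ ⟩
    x₀ * (x₃ * (1# + x₂))     ≡⟨ cong (x₀ *_) e₃ ⟩
    x₀ * 1#                   ≡⟨ *-identityʳ x₀ ⟩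
    x₀                        ∎
    where
    x₂x₀≡1+x₀ : x₂ * x₀ ≡ 1# + x₀
    x₂x₀≡1+x₀ = begin
      x₂ * x₀                             ≡⟨ solve 2 (λ x₂ x₀ → x₂ :* x₀ := x₂ :* x₀ :+ x₂ :* 𝟙 :+ x₂) refl x₂ x₀ ⟩
      x₂ * x₀ + x₂ * 1# + x₂              ≡⟨ cong (λ y → x₂ * x₀ + x₂ * y + x₂) (sym e₁) ⟩
      x₂ * x₀ + x₂ * (x₁ * (1# + x₀)) + x₂ ≡⟨ solve 3 (λ x₀ x₁ x₂ → x₂ :* x₀ :+ x₂ :* (x₁ :* (𝟙 :+ x₀)) :+ x₂
                                                                 := (x₂ :* (𝟙 :+ x₁)) :* (𝟙 :+ x₀))
                                                       refl x₀ x₁ x₂ ⟩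
      (x₂ * (1# + x₁)) * (1# + x₀)        ≡⟨ cong (_* (1# + x₀)) e₂ ⟩
      1# * (1# + x₀)                      ≡⟨ *-identityˡ _ ⟩
      1# + x₀                             ∎

  -- A root t of t² + t + 1 is a primitive cube root of unity, and 2^odd ≡ 2 mod 3.
  cube-root-^-2^odd : ∀ {t} → t * (1# + t) ≡ 1# → ∀ j → t ^ (2 ^ℕ suc (j ℕ.* 2)) ≡ t * t
  cube-root-^-2^odd {t} t[1+t]≡1 zero    = cong (t *_) (*-identityʳ t)
  cube-root-^-2^odd {t} t[1+t]≡1 (suc j) = begin
    t ^ (2 ^ℕ suc (suc (suc (j ℕ.* 2))))   ≡⟨ trans (^-2^suc t (suc (suc (j ℕ.* 2)))) (cong (_^ 2) (^-2^suc t (suc (j ℕ.* 2)))) ⟩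
    ((t ^ (2 ^ℕ suc (j ℕ.* 2))) ^ 2) ^ 2   ≡⟨ cong (λ y → (y ^ 2) ^ 2) (cube-root-^-2^odd t[1+t]≡1 j) ⟩
    ((t * t) ^ 2) ^ 2                      ≡⟨ solve 1 (λ t → ((t :* t) :* ((t :* t) :* 𝟙)) :* (((t :* t) :* ((t :* t) :* 𝟙)) :* 𝟙)
                                                       := (t :* (t :* t)) :* ((t :* (t :* t)) :* (t :* t))) refl t ⟩
    t³ * (t³ * (t * t))                    ≡⟨ cong₂ (λ a b → a * (b * (t * t))) t³≡1 t³≡1 ⟩
    1# * (1# * (t * t))                    ≡⟨ trans (*-identityˡ _) (*-identityˡ _) ⟩
    t * t                                  ∎
    where
    ^-2^suc : ∀ x n → x ^ (2 ^ℕ suc n) ≡ (x ^ (2 ^ℕ n)) ^ 2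
    ^-2^suc x n = trans (cong (x ^_) (ℕ.*-comm 2 (2 ^ℕ n))) (sym (^-assocʳ x (2 ^ℕ n) 2))
    t³ = t * (t * t)
    t³≡1 : t³ ≡ 1#
    t³≡1 = begin
      t * (t * t)              ≡⟨ cong (t *_) (solve 1 (λ t → t :* t := t :* (𝟙 :+ t) :+ t) refl t) ⟩
      t * (t * (1# + t) + t)   ≡⟨ cong (λ y → t * (y + t)) t[1+t]≡1 ⟩
      t * (1# + t)             ≡⟨ t[1+t]≡1 ⟩
      1#                       ∎

odd⇒≡suc[n/2*2] : ∀ n → n % 2 ≡ 1 → n ≡ suc (n / 2 ℕ.* 2)
odd⇒≡suc[n/2*2] n n%2≡1 = trans (m≡m%n+[m/n]*n n 2) (cong (ℕ._+ n / 2 ℕ.* 2) n%2≡1)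

1<2^suc : ∀ n → 1 ℕ.< 2 ^ℕ suc n
1<2^suc n = ℕ.*-monoʳ-≤ 2 (ℕ.m^n>0 2 n)

n<n^2 : ∀ {n} → 1 ℕ.< n → n ℕ.< n ^ℕ 2
n<n^2 {n@(suc _)} 1<n = subst (n ℕ.<_) (cong (n ℕ.*_) (sym (ℕ.*-identityʳ n))) (ℕ.m<m*n n n 1<n)

module FieldOfOrderQ⁴ (h : ℕ) (h-odd : h % 2 ≡ 1) (F : FiniteField ((2 ^ℕ h) ^ℕ 4)) where
  q Q : ℕ
  q = 2 ^ℕ h
  Q = q ^ℕ 2

  h≡suc[h/2*2] : h ≡ suc (h / 2 ℕ.* 2)
  h≡suc[h/2*2] = odd⇒≡suc[n/2*2] h h-odd

  2∣q⁴ : 2 ∣ q ^ℕ 4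
  2∣q⁴ = ∣m⇒∣m*n (q ^ℕ 3) (subst (λ k → 2 ∣ 2 ^ℕ k) (sym h≡suc[h/2*2]) (m∣m*n (2 ^ℕ (h / 2 ℕ.* 2))))

  open CharacteristicTwo F (FiniteFieldProperties.characteristic-two F 2∣q⁴)
  open ≡-Reasoning

  1<q : 1 ℕ.< q
  1<q = subst (λ k → 1 ℕ.< 2 ^ℕ k) (sym h≡suc[h/2*2]) (1<2^suc (h / 2 ℕ.* 2))

  q<Q : q ℕ.< Q
  q<Q = n<n^2 1<q

  φ : Carrier → Carrier
  φ x = x ^ q

  φ-+ : ∀ x y → φ (x + y) ≡ φ x + φ y
  φ-+ = frobenius-+ h

  ^Q≡φ² : ∀ x → x ^ Q ≡ φ (φ x)
  ^Q≡φ² x = trans (cong (x ^_) (cong (q ℕ.*_) (ℕ.*-identityʳ q))) (sym (^-assocʳ x q q))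

  φ⁴≡id : ∀ x → φ (φ (φ (φ x))) ≡ x
  φ⁴≡id x = begin
    φ (φ (φ (φ x)))                  ≡⟨ ^-assocʳ (φ (φ x)) q q ⟩
    φ (φ x) ^ (q ℕ.* q)              ≡⟨ ^-assocʳ (φ x) q (q ℕ.* q) ⟩
    φ x ^ (q ℕ.* (q ℕ.* q))          ≡⟨ ^-assocʳ x q (q ℕ.* (q ℕ.* q)) ⟩
    x ^ (q ℕ.* (q ℕ.* (q ℕ.* q)))    ≡⟨ cong (λ n → x ^ (q ℕ.* (q ℕ.* (q ℕ.* n)))) (sym (ℕ.*-identityʳ q)) ⟩
    x ^ (q ^ℕ 4)                     ≡⟨ fermat x ⟩
    x                                ∎

  φ-preserves-mobius : ∀ {x y} → y * (1# + x) ≡ 1# → φ y * (1# + φ x) ≡ 1#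
  φ-preserves-mobius {x} {y} e = begin
    φ y * (1# + φ x)         ≡⟨ cong (λ z → φ y * (z + φ x)) (sym (1^n≡1 q)) ⟩
    φ y * (φ 1# + φ x)       ≡⟨ cong (φ y *_) (sym (φ-+ 1# x)) ⟩
    φ y * φ (1# + x)         ≡⟨ sym (^-distrib-* y (1# + x) q) ⟩
    φ (y * (1# + x))         ≡⟨ cong φ e ⟩
    φ 1#                     ≡⟨ 1^n≡1 q ⟩
    1#                       ∎

  -- φ commutes with the Möbius map g, so φ a = g a forces a = φ⁴ a = g⁴ a = g a = φ a.  Then a is a
  -- primitive cube root of unity with φ a = a^(2^h) = a², which contradicts a = φ a.
  φ[a]*[1+a]≢1 : ∀ a → φ a * (1# + a) ≢ 1#
  φ[a]*[1+a]≢1 a e₁ = 0≢1 (begin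
    0#              ≡⟨ sym (x+x≡0 a) ⟩
    a + a           ≡⟨ cong (a +_) (sym a*a≡a) ⟩
    a + a * a       ≡⟨ solve 1 (λ a → a :+ a :* a := a :* (𝟙 :+ a)) refl a ⟩
    a * (1# + a)    ≡⟨ a[1+a]≡1 ⟩
    1#              ∎)
    where
    e₂ = φ-preserves-mobius e₁
    e₃ = φ-preserves-mobius e₂
    e₄ : a * (1# + φ (φ (φ a))) ≡ 1#
    e₄ = subst (λ y → y * (1# + φ (φ (φ a))) ≡ 1#) (φ⁴≡id a) (φ-preserves-mobius e₃)
    a≡φa : a ≡ φ a
    a≡φa = mobius-order-three e₂ e₃ e₄
    a[1+a]≡1 : a * (1# + a) ≡ 1#
    a[1+a]≡1 = subst (λ y → y * (1# + a) ≡ 1#) (sym a≡φa) e₁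
    φa≡a*a : φ a ≡ a * a
    φa≡a*a = subst (λ k → a ^ (2 ^ℕ k) ≡ a * a) (sym h≡suc[h/2*2]) (cube-root-^-2^odd a[1+a]≡1 (h / 2))
    a*a≡a : a * a ≡ a
    a*a≡a = trans (sym φa≡a*a) (sym a≡φa)

  module System (A₁₃ A₁₄ A₂₃ A₂₄ A₃₄ : Carrier) where
    Solves : Carrier × Carrier → Set
    Solves (u , v) =
      (A₂₃ * u + A₁₃ * v ≡ 0#) ×
      (A₂₄ * u + A₁₄ * v ≡ 0#) ×
      (A₃₄ * v + A₂₄ * (u ^ q + v ^ Q) + A₂₃ * (u ^ Q + v ^ Q + v ^ q) ≡ 0#) ×
      (A₃₄ * u + A₁₄ * (u ^ q + v ^ Q) + A₁₃ * (u ^ Q + v ^ Q + v ^ q) ≡ 0#)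

    module _ (A₁₃≢0 : A₁₃ ≢ 0#) where
      k B C : Carrier
      k = A₁₃ ⁻¹⟨ A₁₃≢0 ⟩ * A₂₃
      B = A₁₄ + A₁₃ * φ k
      C = A₁₄ * k ^ Q + A₁₃ + A₁₃ * k ^ Q

      v≡k*u : ∀ {u v} → Solves (u , v) → v ≡ k * u
      v≡k*u {u} (eq₁ , _) = trans (*-solveˡ A₁₃≢0 (sym (x+y≡0⇒x≡y eq₁))) (sym (*-assoc _ A₂₃ u))

      fourth-equation-in-u : ∀ {u v} → Solves (u , v) → A₃₄ * u + B * u ^ q + C * u ^ Q ≡ 0#
      fourth-equation-in-u {u} {v} s@(_ , _ , _ , eq₄) = begin
        A₃₄ * u + B * u ^ q + C * u ^ Q
          ≡⟨ solve 8 (λ a₃₄ a₁₄ a₁₃ u u′ u″ k′ k″ →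
                 a₃₄ :* u :+ (a₁₄ :+ a₁₃ :* k′) :* u′ :+ (a₁₄ :* k″ :+ a₁₃ :+ a₁₃ :* k″) :* u″
              := a₃₄ :* u :+ a₁₄ :* (u′ :+ k″ :* u″) :+ a₁₃ :* (u″ :+ k″ :* u″ :+ k′ :* u′))
              refl A₃₄ A₁₄ A₁₃ u (u ^ q) (u ^ Q) (k ^ q) (k ^ Q) ⟩
        A₃₄ * u + A₁₄ * (u ^ q + k ^ Q * u ^ Q) + A₁₃ * (u ^ Q + k ^ Q * u ^ Q + k ^ q * u ^ q)
          ≡⟨ cong₂ (λ y z → A₃₄ * u + A₁₄ * (u ^ q + y) + A₁₃ * (u ^ Q + y + z))
                   (sym (^-distrib-* k u Q)) (sym (^-distrib-* k u q)) ⟩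
        A₃₄ * u + A₁₄ * (u ^ q + (k * u) ^ Q) + A₁₃ * (u ^ Q + (k * u) ^ Q + (k * u) ^ q)
          ≡⟨ cong (λ v → A₃₄ * u + A₁₄ * (u ^ q + v ^ Q) + A₁₃ * (u ^ Q + v ^ Q + v ^ q)) (sym (v≡k*u s)) ⟩
        A₃₄ * u + A₁₄ * (u ^ q + v ^ Q) + A₁₃ * (u ^ Q + v ^ Q + v ^ q)
          ≡⟨ eq₄ ⟩
        0# ∎

      -- B = C = 0 would give φ (φ k) * (1 + φ k) = 1.
      A₃₄BC≢0 : ¬ (A₃₄ ≡ 0# × B ≡ 0# × C ≡ 0#)
      A₃₄BC≢0 (_ , B≡0 , C≡0) = φ[a]*[1+a]≢1 (φ k) (begin
        φ (φ k) * (1# + φ k)  ≡⟨ cong (_* (1# + φ k)) (sym (^Q≡φ² k)) ⟩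
        k ^ Q * (1# + φ k)    ≡⟨ x+y≡0⇒x≡y (*-cancelˡ-0 A₁₃≢0 A₁₃*[k^Q*[1+φk]+1]≡0) ⟩
        1#                    ∎)
        where
        A₁₃*[k^Q*[1+φk]+1]≡0 : A₁₃ * (k ^ Q * (1# + φ k) + 1#) ≡ 0#
        A₁₃*[k^Q*[1+φk]+1]≡0 = begin
          A₁₃ * (k ^ Q * (1# + φ k) + 1#)           ≡⟨ solve 3 (λ a₁₃ k′ k″ → a₁₃ :* (k″ :* (𝟙 :+ k′) :+ 𝟙)
                                                                         := (a₁₃ :* k′) :* k″ :+ a₁₃ :+ a₁₃ :* k″)
                                                               refl A₁₃ (φ k) (k ^ Q) ⟩
          (A₁₃ * φ k) * k ^ Q + A₁₃ + A₁₃ * k ^ Q   ≡⟨ cong (λ y → y * k ^ Q + A₁₃ + A₁₃ * k ^ Q) (sym (x+y≡0⇒x≡y B≡0)) ⟩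
          C                                         ≡⟨ C≡0 ⟩
          0#                                        ∎

      length≤-if-A₁₃≢0 : ∀ {sols} → Unique sols → All Solves sols → length sols ≤ Q
      length≤-if-A₁₃≢0 = injection-into-trinomial-roots⇒length≤ 1<q q<Q A₃₄BC≢0 proj₁ injective fourth-equation-in-u
        where
        injective : ∀ {s t} → Solves s → Solves t → proj₁ s ≡ proj₁ t → s ≡ t
        injective {u , _} s t refl = cong (u ,_) (trans (v≡k*u s) (sym (v≡k*u t)))

    module _ (A₁₃≡0 : A₁₃ ≡ 0#) (A₂₃≢0 : A₂₃ ≢ 0#) where
      u≡0 : ∀ {u v} → Solves (u , v) → u ≡ 0#
      u≡0 {u} {v} (eq₁ , _) = *-cancelˡ-0 A₂₃≢0 (trans (sym (a≡0⇒x+a*y≡x (A₂₃ * u) v A₁₃≡0)) eq₁)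

      third-equation-in-v : ∀ {u v} → Solves (u , v) → A₃₄ * v + A₂₃ * v ^ q + (A₂₄ + A₂₃) * v ^ Q ≡ 0#
      third-equation-in-v {u} {v} s@(_ , _ , eq₃ , _) = begin
        A₃₄ * v + A₂₃ * v ^ q + (A₂₄ + A₂₃) * v ^ Q
          ≡⟨ solve 6 (λ a₃₄ a₂₄ a₂₃ v v′ v″ →
                 a₃₄ :* v :+ a₂₃ :* v′ :+ (a₂₄ :+ a₂₃) :* v″
              := a₃₄ :* v :+ a₂₄ :* (𝟘 :+ v″) :+ a₂₃ :* (𝟘 :+ v″ :+ v′))
              refl A₃₄ A₂₄ A₂₃ v (v ^ q) (v ^ Q) ⟩
        A₃₄ * v + A₂₄ * (0# + v ^ Q) + A₂₃ * (0# + v ^ Q + v ^ q)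
          ≡⟨ cong₂ (λ y z → A₃₄ * v + A₂₄ * (y + v ^ Q) + A₂₃ * (z + v ^ Q + v ^ q))
                   (sym (0^n≡0 (ℕ.<-trans ℕ.z<s 1<q)))
                   (sym (0^n≡0 (ℕ.<-trans ℕ.z<s (ℕ.<-trans 1<q q<Q)))) ⟩
        A₃₄ * v + A₂₄ * (0# ^ q + v ^ Q) + A₂₃ * (0# ^ Q + v ^ Q + v ^ q)
          ≡⟨ cong (λ u → A₃₄ * v + A₂₄ * (u ^ q + v ^ Q) + A₂₃ * (u ^ Q + v ^ Q + v ^ q)) (sym (u≡0 s)) ⟩
        A₃₄ * v + A₂₄ * (u ^ q + v ^ Q) + A₂₃ * (u ^ Q + v ^ Q + v ^ q)
          ≡⟨ eq₃ ⟩
        0# ∎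

      length≤-if-A₂₃≢0 : ∀ {sols} → Unique sols → All Solves sols → length sols ≤ Q
      length≤-if-A₂₃≢0 =
        injection-into-trinomial-roots⇒length≤ 1<q q<Q (λ (_ , A₂₃≡0 , _) → A₂₃≢0 A₂₃≡0) proj₂ injective third-equation-in-v
        where
        injective : ∀ {s t} → Solves s → Solves t → proj₂ s ≡ proj₂ t → s ≡ t
        injective {_ , v} s t refl = cong (_, v) (trans (u≡0 s) (sym (u≡0 t)))

    module _ (A₁₃≡0 : A₁₃ ≡ 0#) (A₂₃≡0 : A₂₃ ≡ 0#) (A₃₄≢0 : A₃₄ ≢ 0#) where
      w : Carrier × Carrier → Carrier
      w (u , v) = u ^ q + v ^ Q

      α β : Carrier
      α = A₃₄ ⁻¹⟨ A₃₄≢0 ⟩ * A₁₄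
      β = A₃₄ ⁻¹⟨ A₃₄≢0 ⟩ * A₂₄

      solve-for-A₃₄-term : ∀ {a x c y z} → a ≡ 0# → A₃₄ * x + c * y + a * z ≡ 0# → x ≡ (A₃₄ ⁻¹⟨ A₃₄≢0 ⟩ * c) * y
      solve-for-A₃₄-term {a} {x} {c} {y} {z} a≡0 eq =
        trans (*-solveˡ A₃₄≢0 (x+y≡0⇒x≡y (trans (sym (a≡0⇒x+a*y≡x _ z a≡0)) eq))) (sym (*-assoc _ c y))

      u≡α*w : ∀ {s} → Solves s → proj₁ s ≡ α * w s
      u≡α*w (_ , _ , _ , eq₄) = solve-for-A₃₄-term A₁₃≡0 eq₄

      v≡β*w : ∀ {s} → Solves s → proj₂ s ≡ β * w s
      v≡β*w (_ , _ , eq₃ , _) = solve-for-A₃₄-term A₂₃≡0 eq₃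

      w-equation : ∀ {s} → Solves s → 1# * w s + φ α * w s ^ q + β ^ Q * w s ^ Q ≡ 0#
      w-equation {s} sol = begin
        1# * w s + X + Y     ≡⟨ +-assoc _ X Y ⟩
        1# * w s + (X + Y)   ≡⟨ cong (_+ (X + Y)) (trans (*-identityˡ (w s)) w≡X+Y) ⟩
        (X + Y) + (X + Y)    ≡⟨ x+x≡0 (X + Y) ⟩
        0#                   ∎
        where
        X = φ α * w s ^ q
        Y = β ^ Q * w s ^ Q
        w≡X+Y : w s ≡ X + Y
        w≡X+Y = cong₂ _+_ (trans (cong (_^ q) (u≡α*w sol)) (^-distrib-* α (w s) q))
                          (trans (cong (_^ Q) (v≡β*w sol)) (^-distrib-* β (w s) Q))

      length≤-if-A₃₄≢0 : ∀ {sols} → Unique sols → All Solves sols → length sols ≤ Q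
      length≤-if-A₃₄≢0 = injection-into-trinomial-roots⇒length≤ 1<q q<Q (λ (1≡0 , _) → 0≢1 (sym 1≡0)) w injective w-equation
        where
        injective : ∀ {s t} → Solves s → Solves t → w s ≡ w t → s ≡ t
        injective s t ws≡wt = cong₂ _,_
          (trans (u≡α*w s) (trans (cong (α *_) ws≡wt) (sym (u≡α*w t))))
          (trans (v≡β*w s) (trans (cong (β *_) ws≡wt) (sym (v≡β*w t))))

    length≤ : ¬ (A₁₃ ≡ 0# × A₂₃ ≡ 0# × A₃₄ ≡ 0#) → ∀ {sols} → Unique sols → All Solves sols → length sols ≤ Q
    length≤ A≢0 with A₁₃ ≟ 0# | A₂₃ ≟ 0# | A₃₄ ≟ 0#
    ... | no  A₁₃≢0 | _         | _         = length≤-if-A₁₃≢0 A₁₃≢0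
    ... | yes A₁₃≡0 | no  A₂₃≢0 | _         = length≤-if-A₂₃≢0 A₁₃≡0 A₂₃≢0
    ... | yes A₁₃≡0 | yes A₂₃≡0 | no  A₃₄≢0 = length≤-if-A₃₄≢0 A₁₃≡0 A₂₃≡0 A₃₄≢0
    ... | yes A₁₃≡0 | yes A₂₃≡0 | yes A₃₄≡0 = ⊥-elim (A≢0 (A₁₃≡0 , A₂₃≡0 , A₃₄≡0))

proposition4p4 : (h : ℕ) → h % 2 ≡ 1 →
  (F : FiniteField ((2 ^ℕ h) ^ℕ 4)) →
  let open FiniteField F
      q = 2 ^ℕ h
  in (A₁₃ A₁₄ A₂₃ A₂₄ A₃₄ : Carrier) →
     ¬ (A₁₃ ≡ 0# × A₂₃ ≡ 0# × A₃₄ ≡ 0#) →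
     (sols : List (Carrier × Carrier)) → Unique sols →
     All (λ { (u , v) →
           (A₂₃ * u + A₁₃ * v ≡ 0#) ×
           (A₂₄ * u + A₁₄ * v ≡ 0#) ×
           (A₃₄ * v + A₂₄ * (u ^ q + v ^ (q ^ℕ 2)) + A₂₃ * (u ^ (q ^ℕ 2) + v ^ (q ^ℕ 2) + v ^ q) ≡ 0#) ×
           (A₃₄ * u + A₁₄ * (u ^ q + v ^ (q ^ℕ 2)) + A₁₃ * (u ^ (q ^ℕ 2) + v ^ (q ^ℕ 2) + v ^ q) ≡ 0#) }) sols →
     length sols ≤ q ^ℕ 2
proposition4p4 h h-odd F A₁₃ A₁₄ A₂₃ A₂₄ A₃₄ A≢0 sols sols! solutions =
  System.length≤ A₁₃ A₁₄ A₂₃ A₂₄ A₃₄ A≢0 sols! (All.map (λ { {_ , _} solution → solution }) solutions)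
  where open FieldOfOrderQ⁴ h h-odd F
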